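{- Let $n,t\in\mathbb{N}$, let $G$ be a ring, let $P:G^n\to G^t$ be a polynomial mapping over $G$ with $P(0)=0$, let $(g_j)_{j\in\mathbb{N}}$ be a sequence of elements of $G^n$ and let $F$ be a finite subset of $G^n$. For any finite coloring of $G^t$ there exist $h\in G^t$ and a nonempty finite set $\gamma\subset\mathbb{N}$ such that, with $(x_1,\dots,x_n)=\sum_{j\in\gamma}g_j\in G^n$, the set $$\{h+P(x_1v_1,\dots,x_nv_n):\ (v_1,\dots,v_n)\in F\}$$ is monochromatic in $G^t$.
   Context: A ring need not be commutative. A polynomial in $n$ variables over $G$ is a finite sum of monomials $c_0x_{i_1}c_1x_{i_2}\cdots x_{i_k}c_k$ ($k\ge0$, $c_i\in G$); a polynomial mapping $P:G^n\to G^t$ over $G$ is one whose $t$ coordinates are polynomials in $n$ variables over $G$. A finite coloring is a map into $\{1,\dots,r\}$ for some $r$; a set is monochromatic if the coloring is constant on it. -}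

module Defs where

open import Level using (Level; _⊔_)
open import Algebra.Bundles using (Ring)
open import Data.Nat using (ℕ)
open import Data.Fin using (Fin)
open import Data.List using (List; []; _∷_; foldr; map)
open import Data.Product using (_×_; _,_)

module RingDefs {c ℓ : Level} (R : Ring c ℓ) where
  open Ring R

  -- A monomial c₀ x_{i₁} c₁ x_{i₂} ⋯ x_{iₖ} cₖ in n variables over R,
  -- represented as the leading coefficient c₀ together with the list
  -- [(i₁ , c₁) , … , (iₖ , cₖ)]  (k ≥ 0).
  record Monomial (n : ℕ) : Set c where
    constructor mono
    field
      lead  : Carrier
      tail′ : List (Fin n × Carrier)

  Polynomial : ℕ → Set c
  Polynomial n = List (Monomial n)

  Vecᴿ : ℕ → Set c
  Vecᴿ n = Fin n → Carrier

  evalTail : ∀ {n} → Vecᴿ n → List (Fin n × Carrier) → Carrier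
  evalTail x []             = 1#
  evalTail x ((i , a) ∷ ms) = (x i * a) * evalTail x ms

  evalMono : ∀ {n} → Monomial n → Vecᴿ n → Carrier
  evalMono (mono a ms) x = a * evalTail x ms

  evalPoly : ∀ {n} → Polynomial n → Vecᴿ n → Carrier
  evalPoly p x = foldr (λ m s → evalMono m x + s) 0# p

  PolyMap : ℕ → ℕ → Set c
  PolyMap n t = Fin t → Polynomial n

  evalMap : ∀ {n t} → PolyMap n t → Vecᴿ n → Vecᴿ t
  evalMap P x k = evalPoly (P k) x

  zeroV : ∀ {n} → Vecᴿ n
  zeroV _ = 0#

  _+V_ : ∀ {n} → Vecᴿ n → Vecᴿ n → Vecᴿ n
  (u +V v) i = u i + v i

  _≈V_ : ∀ {n} → Vecᴿ n → Vecᴿ n → Set ℓ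
  u ≈V v = ∀ i → u i ≈ v i

  sumSeq : ∀ {n} → (ℕ → Vecᴿ n) → List ℕ → Vecᴿ n
  sumSeq g γ = foldr (λ j s → g j +V s) zeroV γ

  _⊙_ : ∀ {n} → Vecᴿ n → Vecᴿ n → Vecᴿ n
  (x ⊙ v) i = x i * v i

-- A map Φ from finite sets of indices to an abelian group is an IP-polynomial of degree ≤ d if
-- d iterated differences Δ_α Φ (β) = Φ (α ∪ β) - Φ α - Φ β kill it.  Since γ ↦ Σ_{j ∈ γ} g_j is
-- additive, every γ ↦ P (x_γ v) is one, into the group Gᵗ.  For a finite system of IP-polynomials
-- vanishing at ∅ we show, for every r, that finitely many translated index sets (a , γ) suffice to
-- make one of the sets {a + p γ} monochromatic under any r-colouring.  This goes by PET induction: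
-- group the system into classes with a common leading part, degree by degree; subtracting the
-- shifts of a pivot of least degree from the shifts of the others yields systems of lexicographically
-- smaller class count, and colour focusing over r + 1 rounds, as in van der Waerden's theorem,
-- lifts the statement for these systems to the original one.

module Submission where

open import Level using (_⊔_)
open import Algebra.Bundles using (AbelianGroup; Ring)
import Algebra.Construct.Pointwise as Pointwise
open import Data.Nat using (ℕ; zero; suc; _≤_; _<_; _^_; _∸_; _⊓_; z≤n; s≤s) renaming (_+_ to _+ℕ_)
open import Data.Nat.Properties
  using (≤-refl; ≤-trans; ≤-reflexive; <⇒≤; <-≤-trans; m≤m+n; m≤n+m; +-suc; 1+n≰n; <-resp₂-≡; m∸n+n≡m; m⊓n≤m; m⊓n≤n)
import Data.Nat.Induction as ℕ
open import Data.Fin using (Fin; zero; suc; combine)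
open import Data.Fin.Properties using (combine-injective) renaming (_≟_ to _≟ᶠ_)
open import Data.Vec using (Vec; []; _∷_; lookup; zipWith; replicate)
open import Data.Vec.Relation.Binary.Lex.Strict using (Lex-<; this; next; <-wellFounded)
open import Data.List using (List; []; _∷_; _++_; map; concatMap; length; cartesianProductWith; allFin)
open import Data.List.Properties using (length-++; length-tabulate; length-map; ++-conicalˡ)
open import Data.List.Extrema.Nat using (max; xs≤max)
open import Data.List.Relation.Unary.All using (All; []; _∷_)
import Data.List.Relation.Unary.All as All
import Data.List.Relation.Unary.All.Properties as AllP
open import Data.List.Relation.Unary.All.Properties.Core using (¬Any⇒All¬)
open import Data.List.Relation.Unary.Any using (Any; here; there)
import Data.List.Relation.Unary.Any as Any
import Data.List.Relation.Unary.Any.Properties as AnyP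
open import Data.List.Relation.Unary.Unique.Propositional using (Unique; []; _∷_)
import Data.List.Relation.Unary.Unique.Propositional.Properties as Unique
open import Data.List.Relation.Binary.Pointwise using (Pointwise; []; _∷_; Pointwise-length)
open import Data.List.Membership.Propositional using (_∈_; lose; find)
open import Data.List.Membership.Propositional.Properties
  using (∈-∃++; ∈-++⁻; ∈-++⁺ˡ; ∈-++⁺ʳ; ∈-allFin; ∈-map⁺; ∈-map⁻; ∈-concatMap⁺; ∈-concatMap⁻;
         ∈-cartesianProductWith⁺)
open import Data.Product using (Σ; ∃; _×_; _,_; proj₁; proj₂)
open import Data.Sum using (_⊎_; inj₁; inj₂; [_,_]′)
open import Data.Empty using (⊥; ⊥-elim)
open import Function using (_∘_; id)
open import Induction.WellFounded using (WellFounded; Acc; acc)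
open import Relation.Nullary using (yes; no)
open import Relation.Binary.Core using (_Preserves_⟶_)
open import Relation.Binary.PropositionalEquality as ≡ using (_≡_; _≢_)
open import Defs

module AbelianGroupSolver {c ℓ} (G : AbelianGroup c ℓ) where
  open AbelianGroup G renaming (_∙_ to _+_; ε to 0#; _⁻¹ to -_)
  open import Algebra.Definitions.RawMonoid rawMonoid using () renaming (_×_ to _·_)
  open import Algebra.Properties.Monoid.Mult monoid using (×-homo-+)
  open import Algebra.Properties.CommutativeSemigroup commutativeSemigroup using (interchange)
  open import Algebra.Properties.AbelianGroup G using (⁻¹-∙-comm; ⁻¹-anti-homo‿-)
  open import Algebra.Properties.Group group using (ε⁻¹≈ε)
  open import Relation.Binary.Reasoning.Setoid setoid

  infixl 6 _⊕_ _⊖_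
  infix 8 ⊝_

  data Expr (n : ℕ) : Set where
    var : Fin n → Expr n
    ∅   : Expr n
    _⊕_ : Expr n → Expr n → Expr n
    ⊝_  : Expr n → Expr n

  _⊖_ : ∀ {n} → Expr n → Expr n → Expr n
  a ⊖ b = a ⊕ ⊝ b

  ⟦_⟧ : ∀ {n} → Expr n → Vec Carrier n → Carrier
  ⟦ var i ⟧ ρ = lookup ρ i
  ⟦ ∅ ⟧     ρ = 0#
  ⟦ a ⊕ b ⟧ ρ = ⟦ a ⟧ ρ + ⟦ b ⟧ ρ
  ⟦ ⊝ a ⟧   ρ = - ⟦ a ⟧ ρ

  -- A normal form counts the positive and the negative occurrences of each variable.
  Normal : ℕ → Set
  Normal n = Vec ℕ n × Vec ℕ n

  ∑× : ∀ {n} → Vec ℕ n → Vec Carrier n → Carrier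
  ∑× []       []       = 0#
  ∑× (k ∷ ks) (x ∷ xs) = k · x + ∑× ks xs

  ⟦_⟧⇓ : ∀ {n} → Normal n → Vec Carrier n → Carrier
  ⟦ p , q ⟧⇓ ρ = ∑× p ρ + - ∑× q ρ

  unit : ∀ {n} → Fin n → Vec ℕ n
  unit {suc n} zero = 1 ∷ replicate n 0
  unit (suc i)      = 0 ∷ unit i

  count : ∀ {n} → Expr n → Normal n
  count (var i) = unit i , replicate _ 0
  count ∅       = replicate _ 0 , replicate _ 0
  count (a ⊕ b) with count a | count b
  ... | p , q | p′ , q′ = zipWith _+ℕ_ p p′ , zipWith _+ℕ_ q q′
  count (⊝ a)   with count a
  ... | p , q = q , p

  -- Cancelling common occurrences makes the normal form unique.
  cancel : ∀ {n} → Normal n → Normal n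
  cancel (p , q) = zipWith _∸_ p (zipWith _⊓_ p q) , zipWith _∸_ q (zipWith _⊓_ p q)

  normalise : ∀ {n} → Expr n → Normal n
  normalise e = cancel (count e)

  ∑×-+ : ∀ {n} (u v : Vec ℕ n) ρ → ∑× (zipWith _+ℕ_ u v) ρ ≈ ∑× u ρ + ∑× v ρ
  ∑×-+ []       []       []       = sym (identityˡ 0#)
  ∑×-+ (a ∷ u) (b ∷ v) (x ∷ ρ) = begin
    (a +ℕ b) · x + ∑× (zipWith _+ℕ_ u v) ρ  ≈⟨ ∙-cong (×-homo-+ x a b) (∑×-+ u v ρ) ⟩
    (a · x + b · x) + (∑× u ρ + ∑× v ρ)     ≈⟨ interchange _ _ _ _ ⟩
    (a · x + ∑× u ρ) + (b · x + ∑× v ρ)     ∎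

  ∑×-0 : ∀ {n} (ρ : Vec Carrier n) → ∑× (replicate n 0) ρ ≈ 0#
  ∑×-0 []      = refl
  ∑×-0 (x ∷ ρ) = trans (identityˡ _) (∑×-0 ρ)

  ∑×-unit : ∀ {n} (i : Fin n) ρ → ∑× (unit i) ρ ≈ lookup ρ i
  ∑×-unit zero    (x ∷ ρ) = trans (∙-cong (identityʳ x) (∑×-0 ρ)) (identityʳ x)
  ∑×-unit (suc i) (x ∷ ρ) = trans (identityˡ _) (∑×-unit i ρ)

  x-0≈x : ∀ x → x + - 0# ≈ x
  x-0≈x x = trans (∙-congˡ ε⁻¹≈ε) (identityʳ x)

  [x-y]+[u-v]≈[x+u]-[y+v] : ∀ x y u v → (x + - y) + (u + - v) ≈ (x + u) + - (y + v)
  [x-y]+[u-v]≈[x+u]-[y+v] x y u v = trans (interchange x (- y) u (- v)) (∙-congˡ (⁻¹-∙-comm y v))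

  [x+z]-[y+z]≈x-y : ∀ x y z → (x + z) + - (y + z) ≈ x + - y
  [x+z]-[y+z]≈x-y x y z = begin
    (x + z) + - (y + z)      ≈⟨ ∙-congˡ (sym (⁻¹-∙-comm y z)) ⟩
    (x + z) + (- y + - z)    ≈⟨ interchange x z (- y) (- z) ⟩
    (x + - y) + (z + - z)    ≈⟨ ∙-congˡ (inverseʳ z) ⟩
    (x + - y) + 0#           ≈⟨ identityʳ _ ⟩
    x + - y                  ∎

  count-correct : ∀ {n} (e : Expr n) ρ → ⟦ count e ⟧⇓ ρ ≈ ⟦ e ⟧ ρ
  count-correct (var i) ρ = trans (∙-cong (∑×-unit i ρ) (⁻¹-cong (∑×-0 ρ))) (x-0≈x _)
  count-correct ∅       ρ = trans (∙-cong (∑×-0 ρ) (⁻¹-cong (∑×-0 ρ))) (x-0≈x 0#)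
  count-correct (a ⊕ b) ρ with count a | count b | count-correct a ρ | count-correct b ρ
  ... | p , q | p′ , q′ | ha | hb = begin
    ∑× (zipWith _+ℕ_ p p′) ρ + - ∑× (zipWith _+ℕ_ q q′) ρ
      ≈⟨ ∙-cong (∑×-+ p p′ ρ) (⁻¹-cong (∑×-+ q q′ ρ)) ⟩
    (∑× p ρ + ∑× p′ ρ) + - (∑× q ρ + ∑× q′ ρ)
      ≈⟨ sym ([x-y]+[u-v]≈[x+u]-[y+v] _ _ _ _) ⟩
    (∑× p ρ + - ∑× q ρ) + (∑× p′ ρ + - ∑× q′ ρ)
      ≈⟨ ∙-cong ha hb ⟩
    ⟦ a ⟧ ρ + ⟦ b ⟧ ρ ∎
  count-correct (⊝ a)   ρ with count a | count-correct a ρ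
  ... | p , q | ha = trans (sym (⁻¹-anti-homo‿- _ _)) (⁻¹-cong ha)

  ∸⊓+⊓≡ˡ : ∀ {n} (p q : Vec ℕ n) → zipWith _+ℕ_ (zipWith _∸_ p (zipWith _⊓_ p q)) (zipWith _⊓_ p q) ≡ p
  ∸⊓+⊓≡ˡ []      []      = ≡.refl
  ∸⊓+⊓≡ˡ (a ∷ p) (b ∷ q) = ≡.cong₂ _∷_ (m∸n+n≡m (m⊓n≤m a b)) (∸⊓+⊓≡ˡ p q)

  ∸⊓+⊓≡ʳ : ∀ {n} (p q : Vec ℕ n) → zipWith _+ℕ_ (zipWith _∸_ q (zipWith _⊓_ p q)) (zipWith _⊓_ p q) ≡ q
  ∸⊓+⊓≡ʳ []      []      = ≡.refl
  ∸⊓+⊓≡ʳ (a ∷ p) (b ∷ q) = ≡.cong₂ _∷_ (m∸n+n≡m (m⊓n≤n a b)) (∸⊓+⊓≡ʳ p q)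

  cancel-correct : ∀ {n} (v : Normal n) ρ → ⟦ cancel v ⟧⇓ ρ ≈ ⟦ v ⟧⇓ ρ
  cancel-correct (p , q) ρ = begin
    ∑× (zipWith _∸_ p m) ρ + - ∑× (zipWith _∸_ q m) ρ
      ≈⟨ sym ([x+z]-[y+z]≈x-y _ _ _) ⟩
    (∑× (zipWith _∸_ p m) ρ + ∑× m ρ) + - (∑× (zipWith _∸_ q m) ρ + ∑× m ρ)
      ≈⟨ ∙-cong (sym (∑×-+ (zipWith _∸_ p m) m ρ)) (⁻¹-cong (sym (∑×-+ (zipWith _∸_ q m) m ρ))) ⟩
    ∑× (zipWith _+ℕ_ (zipWith _∸_ p m) m) ρ + - ∑× (zipWith _+ℕ_ (zipWith _∸_ q m) m) ρ
      ≡⟨ ≡.cong₂ (λ u v → ∑× u ρ + - ∑× v ρ) (∸⊓+⊓≡ˡ p q) (∸⊓+⊓≡ʳ p q) ⟩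
    ∑× p ρ + - ∑× q ρ ∎
    where m = zipWith _⊓_ p q

  correct : ∀ {n} (e : Expr n) ρ → ⟦ normalise e ⟧⇓ ρ ≈ ⟦ e ⟧ ρ
  correct e ρ = trans (cancel-correct (count e) ρ) (count-correct e ρ)

  open import Relation.Binary.Reflection setoid var ⟦_⟧ (λ e → ⟦ normalise e ⟧⇓) correct public
    using (solve; _⊜_)

module IPPolynomials {c ℓ} (G : AbelianGroup c ℓ) where
  open AbelianGroup G renaming (_∙_ to _+_; ε to 0#; _⁻¹ to -_)
  open AbelianGroupSolver G

  -- Maps on the finite subsets of ℕ, a subset being given by any list of its elements.
  IPMap : Set c
  IPMap = List ℕ → Carrier

  infixl 6 _+ᶠ_ _-ᶠ_
  infix 4 _≈ᶠ_

  0ᶠ : IPMap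
  0ᶠ _ = 0#

  _+ᶠ_ _-ᶠ_ : IPMap → IPMap → IPMap
  (Φ +ᶠ Ψ) β = Φ β + Ψ β
  (Φ -ᶠ Ψ) β = Φ β + - Ψ β

  _≈ᶠ_ : IPMap → IPMap → Set ℓ
  Φ ≈ᶠ Ψ = ∀ β → Φ β ≈ Ψ β

  Δ : List ℕ → IPMap → IPMap
  Δ α Φ β = (Φ (α ++ β) + - Φ α) + - Φ β

  shift : List ℕ → IPMap → IPMap
  shift α Φ β = Φ (α ++ β) + - Φ α

  -- Φ is an IP-polynomial of degree at most d with Φ ∅ = 0.
  Poly≤ : ℕ → IPMap → Set ℓ
  Poly≤ zero    Φ = Φ ≈ᶠ 0ᶠ
  Poly≤ (suc d) Φ = ∀ α → Poly≤ d (Δ α Φ)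

  Δ-cong : ∀ α {Φ Ψ} → Φ ≈ᶠ Ψ → Δ α Φ ≈ᶠ Δ α Ψ
  Δ-cong α Φ≈Ψ β = ∙-cong (∙-cong (Φ≈Ψ (α ++ β)) (⁻¹-cong (Φ≈Ψ α))) (⁻¹-cong (Φ≈Ψ β))

  Δ-+ : ∀ α Φ Ψ → Δ α (Φ +ᶠ Ψ) ≈ᶠ Δ α Φ +ᶠ Δ α Ψ
  Δ-+ α Φ Ψ β = solve 6 (λ x y z u v w → ((x ⊕ u) ⊖ (y ⊕ v)) ⊖ (z ⊕ w) ⊜ ((x ⊖ y) ⊖ z) ⊕ ((u ⊖ v) ⊖ w))
    refl (Φ (α ++ β)) (Φ α) (Φ β) (Ψ (α ++ β)) (Ψ α) (Ψ β)

  Δ-neg : ∀ α Φ → Δ α (λ β → - Φ β) ≈ᶠ (λ β → - Δ α Φ β)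
  Δ-neg α Φ β = solve 3 (λ x y z → (⊝ x ⊖ ⊝ y) ⊖ ⊝ z ⊜ ⊝ ((x ⊖ y) ⊖ z)) refl (Φ (α ++ β)) (Φ α) (Φ β)

  Δ-0ᶠ : ∀ α {Φ} → Φ ≈ᶠ 0ᶠ → Δ α Φ ≈ᶠ 0ᶠ
  Δ-0ᶠ α Φ≈0 β = trans (Δ-cong α Φ≈0 β) (solve 0 ((∅ ⊖ ∅) ⊖ ∅ ⊜ ∅) refl)

  Δ-split : ∀ α β Φ → Φ (α ++ β) ≈ (Φ α + Φ β) + Δ α Φ β
  Δ-split α β Φ = solve 3 (λ x y z → x ⊜ (y ⊕ z) ⊕ ((x ⊖ y) ⊖ z)) refl (Φ (α ++ β)) (Φ α) (Φ β)

  shift≈+Δ : ∀ α Φ → shift α Φ ≈ᶠ Φ +ᶠ Δ α Φ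
  shift≈+Δ α Φ β = solve 3 (λ x y z → x ⊖ y ⊜ z ⊕ ((x ⊖ y) ⊖ z)) refl (Φ (α ++ β)) (Φ α) (Φ β)

  Poly≤-resp : ∀ d {Φ Ψ} → Φ ≈ᶠ Ψ → Poly≤ d Φ → Poly≤ d Ψ
  Poly≤-resp zero    Φ≈Ψ p β = trans (sym (Φ≈Ψ β)) (p β)
  Poly≤-resp (suc d) Φ≈Ψ p α = Poly≤-resp d (Δ-cong α Φ≈Ψ) (p α)

  Poly≤-0ᶠ : ∀ d → Poly≤ d 0ᶠ
  Poly≤-0ᶠ zero    β = refl
  Poly≤-0ᶠ (suc d) α = Poly≤-resp d (λ β → sym (Δ-0ᶠ α (λ _ → refl) β)) (Poly≤-0ᶠ d)

  Poly≤-+ : ∀ d {Φ Ψ} → Poly≤ d Φ → Poly≤ d Ψ → Poly≤ d (Φ +ᶠ Ψ)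
  Poly≤-+ zero    p q β = trans (∙-cong (p β) (q β)) (identityʳ 0#)
  Poly≤-+ (suc d) {Φ} {Ψ} p q α = Poly≤-resp d (λ β → sym (Δ-+ α Φ Ψ β)) (Poly≤-+ d (p α) (q α))

  Poly≤-neg : ∀ d {Φ} → Poly≤ d Φ → Poly≤ d (λ β → - Φ β)
  Poly≤-neg zero    p β = trans (⁻¹-cong (p β)) (solve 0 (⊝ ∅ ⊜ ∅) refl)
  Poly≤-neg (suc d) {Φ} p α = Poly≤-resp d (λ β → sym (Δ-neg α Φ β)) (Poly≤-neg d (p α))

  Poly≤-sub : ∀ d {Φ Ψ} → Poly≤ d Φ → Poly≤ d Ψ → Poly≤ d (Φ -ᶠ Ψ)
  Poly≤-sub d p q = Poly≤-+ d p (Poly≤-neg d q)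

  Poly≤-suc : ∀ d {Φ} → Poly≤ d Φ → Poly≤ (suc d) Φ
  Poly≤-suc zero    p α = Δ-0ᶠ α p
  Poly≤-suc (suc d) p α = Poly≤-suc d (p α)

  Poly≤-mono : ∀ {d d′ Φ} → d ≤ d′ → Poly≤ d Φ → Poly≤ d′ Φ
  Poly≤-mono {zero} {zero}    z≤n      p = p
  Poly≤-mono {zero} {suc d′}  z≤n      p = Poly≤-suc d′ (Poly≤-mono {zero} {d′} z≤n p)
  Poly≤-mono {suc d} {suc d′} (s≤s le) p α = Poly≤-mono le (p α)

  -- Δ ∅ Φ ∅ = - Φ ∅
  Poly≤-∅ : ∀ d {Φ} → Poly≤ d Φ → Φ [] ≈ 0#
  Poly≤-∅ zero    p = p []
  Poly≤-∅ (suc d) {Φ} p = begin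
    Φ []                              ≈⟨ solve 1 (λ x → x ⊜ ⊝ ((x ⊖ x) ⊖ x)) refl (Φ []) ⟩
    - ((Φ [] + - Φ []) + - Φ [])      ≈⟨ ⁻¹-cong (Poly≤-∅ d (p [])) ⟩
    - 0#                              ≈⟨ solve 0 (⊝ ∅ ⊜ ∅) refl ⟩
    0#                                ∎
    where open import Relation.Binary.Reasoning.Setoid setoid

  Poly≤-shift : ∀ d {Φ} → Poly≤ d Φ → ∀ α → Poly≤ d (shift α Φ)
  Poly≤-shift zero    p α β = trans (∙-cong (p _) (⁻¹-cong (p α))) (solve 0 (∅ ⊖ ∅ ⊜ ∅) refl)
  Poly≤-shift (suc d) {Φ} p α =
    Poly≤-resp (suc d) (λ β → sym (shift≈+Δ α Φ β)) (Poly≤-+ (suc d) p (Poly≤-suc d (p α)))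

Unique-⊆⇒length≤ : ∀ {a} {A : Set a} {xs ys : List A} → Unique xs → (∀ {x} → x ∈ xs → x ∈ ys) → length xs ≤ length ys
Unique-⊆⇒length≤ {xs = []}     _            _    = z≤n
Unique-⊆⇒length≤ {xs = x ∷ xs} (x∉xs ∷ uxs) xs⊆ys with ∈-∃++ (xs⊆ys (here ≡.refl))
... | us , vs , ≡.refl = ≡.subst (suc (length xs) ≤_) (≡.sym length-us++x∷vs)
                           (s≤s (Unique-⊆⇒length≤ uxs xs⊆us++vs))
  where
  length-us++x∷vs : length (us ++ x ∷ vs) ≡ suc (length (us ++ vs))
  length-us++x∷vs = ≡.trans (length-++ us) (≡.trans (+-suc (length us) (length vs)) (≡.cong suc (≡.sym (length-++ us))))
  xs⊆us++vs : ∀ {y} → y ∈ xs → y ∈ us ++ vs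
  xs⊆us++vs {y} y∈xs with ∈-++⁻ us (xs⊆ys (there y∈xs))
  ... | inj₁ y∈us           = ∈-++⁺ˡ y∈us
  ... | inj₂ (here ≡.refl)  = ⊥-elim (All.lookup x∉xs y∈xs ≡.refl)
  ... | inj₂ (there y∈vs)   = ∈-++⁺ʳ us y∈vs

Unique⇒length≤ : ∀ {r} {xs : List (Fin r)} → Unique xs → length xs ≤ r
Unique⇒length≤ {r} {xs} uxs = ≡.subst (length xs ≤_) (length-tabulate id) (Unique-⊆⇒length≤ uxs (λ {x} _ → ∈-allFin x))

module _ {a b} {X : Set a} {Y : Set b} {r : ℕ} (c : Y → X → Fin r) where

  jointColouring : (ys : List Y) → X → Fin (r ^ length ys)
  jointColouring []       x = zero
  jointColouring (y ∷ ys) x = combine (c y x) (jointColouring ys x)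

  jointColouring-injective : ∀ ys {x x′} → jointColouring ys x ≡ jointColouring ys x′ → All (λ y → c y x ≡ c y x′) ys
  jointColouring-injective []       _  = []
  jointColouring-injective (y ∷ ys) eq with combine-injective _ _ _ _ eq
  ... | cx≡cx′ , rest≡ = cx≡cx′ ∷ jointColouring-injective ys rest≡

  jointColouring-cong : ∀ ys {x x′} → All (λ y → c y x ≡ c y x′) ys → jointColouring ys x ≡ jointColouring ys x′
  jointColouring-cong []       []              = ≡.refl
  jointColouring-cong (y ∷ ys) (cx≡cx′ ∷ rest) = ≡.cong₂ combine cx≡cx′ (jointColouring-cong ys rest)

IndexSet : ℕ → ℕ → List ℕ → Set
IndexSet M N γ = γ ≢ [] × Unique γ × All (λ i → M ≤ i × i < N) γ

IndexSet-widen : ∀ {M N N′ γ} → N ≤ N′ → IndexSet M N γ → IndexSet M N′ γ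
IndexSet-widen N≤N′ (γ≢[] , uγ , range) = γ≢[] , uγ , All.map (λ (M≤i , i<N) → M≤i , <-≤-trans i<N N≤N′) range

IndexSet-lower : ∀ {M M′ N γ} → M′ ≤ M → IndexSet M N γ → IndexSet M′ N γ
IndexSet-lower M′≤M (γ≢[] , uγ , range) = γ≢[] , uγ , All.map (λ (M≤i , i<N) → ≤-trans M′≤M M≤i , i<N) range

IndexSet⇒< : ∀ {M N γ} → IndexSet M N γ → M < N
IndexSet⇒< {γ = []}    (γ≢[] , _)                       = ⊥-elim (γ≢[] ≡.refl)
IndexSet⇒< {γ = _ ∷ _} (_ , _ , (M≤i , i<N) ∷ _) = <-≤-trans (s≤s M≤i) i<N

IndexSet-++ : ∀ {M N N′ α β} → IndexSet M N α → IndexSet N N′ β → IndexSet M N′ (α ++ β)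
IndexSet-++ {α = α} {β} α-set@(α≢[] , uα , α-range) β-set@(_ , uβ , β-range) =
  α≢[] ∘ ++-conicalˡ α β , Unique.++⁺ uα uβ disjoint ,
  AllP.++⁺ (IndexSet-widen (<⇒≤ (IndexSet⇒< β-set)) α-set .proj₂ .proj₂)
           (IndexSet-lower (<⇒≤ (IndexSet⇒< α-set)) β-set .proj₂ .proj₂)
  where
  disjoint : ∀ {i} → i ∈ α × i ∈ β → ⊥
  disjoint (i∈α , i∈β) = 1+n≰n (≤-trans (proj₂ (All.lookup α-range i∈α)) (proj₁ (All.lookup β-range i∈β)))

module PETFamilies {c ℓ} (G : AbelianGroup c ℓ) where
  open AbelianGroup G renaming (_∙_ to _+_; ε to 0#; _⁻¹ to -_)
  open AbelianGroupSolver G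
  open IPPolynomials G

  infix 4 _∈≈_

  _∈≈_ : IPMap → List IPMap → Set (c ⊔ ℓ)
  Φ ∈≈ Qs = Any (_≈ᶠ Φ) Qs

  Covers : IPMap → List (List ℕ) → List IPMap → List IPMap → Set (c ⊔ ℓ)
  Covers q E Ps Qs = ∀ {p e} → p ∈ Ps → e ∈ E → shift e p -ᶠ shift e q ∈≈ Qs

  IPPoly : ℕ → Set (c ⊔ ℓ)
  IPPoly d = Σ IPMap (Poly≤ d)

  -- A class of degree D + 1 has a leading map R; its members are the maps R + L.
  Class : ℕ → Set (c ⊔ ℓ)
  Class D = IPPoly (suc D) × List (IPPoly D)

  membersOf : ∀ {D} → Class D → List IPMap
  membersOf (R , Ls) = map (λ L → proj₁ R +ᶠ proj₁ L) Ls

  classMembers : ∀ {D} → List (Class D) → List IPMap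
  classMembers = concatMap membersOf

  data Family : ℕ → Set (c ⊔ ℓ) where
    none onlyZero : Family zero
    step          : ∀ {D} → List (Class D) → Family D → Family (suc D)

  members : ∀ {D} → Family D → List IPMap
  members none        = []
  members onlyZero    = 0ᶠ ∷ []
  members (step cs f) = classMembers cs ++ members f

  weight : ∀ {D} → Family D → Vec ℕ (suc D)
  weight none        = 0 ∷ []
  weight onlyZero    = 1 ∷ []
  weight (step cs f) = length cs ∷ weight f

  _<ʷ_ : ∀ {n} → Vec ℕ n → Vec ℕ n → Set
  _<ʷ_ = Lex-< _≡_ _<_

  <ʷ-wellFounded : ∀ {n} → WellFounded (_<ʷ_ {n})
  <ʷ-wellFounded = <-wellFounded ≡.trans (proj₁ <-resp₂-≡) ℕ.<-wellFounded

  ∈-classMembers⁺ : ∀ {D} {cs : List (Class D)} {R Ls L} → (R , Ls) ∈ cs → L ∈ Ls →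
    proj₁ R +ᶠ proj₁ L ∈ classMembers cs
  ∈-classMembers⁺ c∈cs L∈Ls = ∈-concatMap⁺ membersOf (lose c∈cs (∈-map⁺ _ L∈Ls))

  ∈-classMembers⁻ : ∀ {D} (cs : List (Class D)) {p} → p ∈ classMembers cs →
    ∃ λ R → ∃ λ Ls → ∃ λ L → (R , Ls) ∈ cs × L ∈ Ls × p ≡ proj₁ R +ᶠ proj₁ L
  ∈-classMembers⁻ cs p∈ with find (∈-concatMap⁻ membersOf {xs = cs} p∈)
  ... | (R , Ls) , c∈cs , p∈c with ∈-map⁻ _ p∈c
  ...   | L , L∈Ls , p≡R+L = R , Ls , L , c∈cs , L∈Ls , p≡R+L

  classMembers-poly : ∀ {D} (cs : List (Class D)) {p} → p ∈ classMembers cs → Poly≤ (suc D) p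
  classMembers-poly {D} cs p∈ with ∈-classMembers⁻ cs p∈
  ... | (R , R-poly) , Ls , (L , L-poly) , _ , _ , ≡.refl = Poly≤-+ (suc D) R-poly (Poly≤-suc D L-poly)

  record Reduction {D} (f : Family D) : Set (c ⊔ ℓ) where
    field
      pivot       : IPMap
      pivot-poly  : Poly≤ D pivot
      others      : List IPMap
      others-poly : ∀ {p} → p ∈ others → Poly≤ D p
      members⊆    : ∀ {p} → p ∈ members f → p ∈ pivot ∷ others
      reduce      : ∀ E → Σ (Family D) λ f′ → weight f′ <ʷ weight f × Covers pivot E others (members f′)

  shiftPoly : ∀ {d} → List ℕ → IPPoly d → IPPoly d
  shiftPoly e (Φ , Φ-poly) = shift e Φ , Poly≤-shift _ Φ-poly e

  ΔPoly : ∀ {d} → List ℕ → IPPoly (suc d) → IPPoly d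
  ΔPoly e (Φ , Φ-poly) = Δ e Φ , Φ-poly e

  shift-+≈+lower : ∀ e R L q →
    R +ᶠ (Δ e R +ᶠ shift e L -ᶠ shift e q) ≈ᶠ shift e (R +ᶠ L) -ᶠ shift e q
  shift-+≈+lower e R L q β =
    solve 7 (λ r r′ r₀ l′ l₀ q′ q₀ → r ⊕ ((((r′ ⊖ r₀) ⊖ r) ⊕ (l′ ⊖ l₀)) ⊖ (q′ ⊖ q₀)) ⊜ ((r′ ⊕ l′) ⊖ (r₀ ⊕ l₀)) ⊖ (q′ ⊖ q₀))
      refl (R β) (R (e ++ β)) (R e) (L (e ++ β)) (L e) (q (e ++ β)) (q e)

  shift-+≈-+lower : ∀ e R R₀ L →
    (R -ᶠ R₀) +ᶠ (Δ e R +ᶠ shift e L -ᶠ Δ e R₀) ≈ᶠ shift e (R +ᶠ L) -ᶠ shift e R₀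
  shift-+≈-+lower e R R₀ L β =
    solve 8 (λ r s r′ r₀ l′ l₀ s′ s₀ →
               (r ⊖ s) ⊕ ((((r′ ⊖ r₀) ⊖ r) ⊕ (l′ ⊖ l₀)) ⊖ ((s′ ⊖ s₀) ⊖ s)) ⊜ ((r′ ⊕ l′) ⊖ (r₀ ⊕ l₀)) ⊖ (s′ ⊖ s₀))
      refl (R β) (R₀ β) (R (e ++ β)) (R e) (L (e ++ β)) (L e) (R₀ (e ++ β)) (R₀ e)

  shift-+≈shift : ∀ e R L → shift e L ≈ᶠ shift e (R +ᶠ L) -ᶠ shift e R
  shift-+≈shift e R L β =
    solve 4 (λ l′ l₀ r′ r₀ → l′ ⊖ l₀ ⊜ ((r′ ⊕ l′) ⊖ (r₀ ⊕ l₀)) ⊖ (r′ ⊖ r₀)) refl (L (e ++ β)) (L e) (R (e ++ β)) (R e)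

  lowerPart : ∀ {D} → (List ℕ → IPPoly D) → IPPoly (suc D) → IPPoly D → List ℕ → IPPoly D
  lowerPart {D} Q (R , R-poly) (L , L-poly) e =
    Δ e R +ᶠ shift e L -ᶠ proj₁ (Q e) ,
    Poly≤-sub D (Poly≤-+ D (R-poly e) (Poly≤-shift D L-poly e)) (proj₂ (Q e))

  reclass : ∀ {D} → (IPPoly (suc D) → IPPoly (suc D)) → (List ℕ → IPPoly D) → List (List ℕ) → Class D → Class D
  reclass lead Q E (R , Ls) = lead R , cartesianProductWith (lowerPart Q R) Ls E

  reclass-covers : ∀ {D} lead Q E q (cs : List (Class D)) →
    (∀ R L e → proj₁ (lead R) +ᶠ proj₁ (lowerPart Q R L e) ≈ᶠ shift e (proj₁ R +ᶠ proj₁ L) -ᶠ shift e q) →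
    Covers q E (classMembers cs) (classMembers (map (reclass lead Q E) cs))
  reclass-covers lead Q E q cs update p∈ e∈ with ∈-classMembers⁻ cs p∈
  ... | R , Ls , L , c∈cs , L∈Ls , ≡.refl =
    lose (∈-classMembers⁺ (∈-map⁺ (reclass lead Q E) c∈cs) (∈-cartesianProductWith⁺ (lowerPart Q R) L∈Ls e∈))
         (update R L _)

  empty : ∀ D → Family D
  empty zero    = none
  empty (suc D) = step [] (empty D)

  -- Maps of degree ≤ 0 vanish, so at degree 0 all of hs is represented by 0ᶠ.
  singletons : ∀ D → List (IPPoly D) → Family D
  singletons zero    hs = onlyZero
  singletons (suc D) hs = step (map (λ h → h , (0ᶠ , Poly≤-0ᶠ D) ∷ []) hs) (empty D)

  singletons-covers : ∀ D {hs h} → h ∈ hs → proj₁ h ∈≈ members (singletons D hs)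
  singletons-covers zero    {h = Φ , Φ≈0} _ = here (λ β → sym (Φ≈0 β))
  singletons-covers (suc D) h∈hs =
    AnyP.++⁺ˡ (lose (∈-classMembers⁺ (∈-map⁺ _ h∈hs) (here ≡.refl)) (λ β → identityʳ _))

  reduction-lower : ∀ {D} cs (f : Family D) → Reduction f → Reduction (step cs f)
  reduction-lower {D} cs f red = record
    { pivot       = pivot
    ; pivot-poly  = Poly≤-suc D pivot-poly
    ; others      = classMembers cs ++ others
    ; others-poly = others-poly′
    ; members⊆    = members⊆′
    ; reduce      = reduce′
    }
    where
    open Reduction red
    others-poly′ : ∀ {p} → p ∈ classMembers cs ++ others → Poly≤ (suc D) p
    others-poly′ p∈ with ∈-++⁻ (classMembers cs) p∈
    ... | inj₁ p∈cs     = classMembers-poly cs p∈cs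
    ... | inj₂ p∈others = Poly≤-suc D (others-poly p∈others)
    members⊆′ : ∀ {p} → p ∈ classMembers cs ++ members f → p ∈ pivot ∷ classMembers cs ++ others
    members⊆′ p∈ with ∈-++⁻ (classMembers cs) p∈
    ... | inj₁ p∈cs = there (∈-++⁺ˡ p∈cs)
    ... | inj₂ p∈f with members⊆ p∈f
    ...   | here p≡pivot   = here p≡pivot
    ...   | there p∈others = there (∈-++⁺ʳ (classMembers cs) p∈others)
    Q : List ℕ → IPPoly D
    Q e = shiftPoly e (pivot , pivot-poly)
    reduce′ : ∀ E → Σ (Family (suc D)) λ f′ → weight f′ <ʷ weight (step cs f) ×
                Covers pivot E (classMembers cs ++ others) (members f′)
    reduce′ E with reduce E
    ... | f′ , f′<f , covers =
      step cs′ f′ , next (length-map _ cs) f′<f , covers′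
      where
      cs′ = map (reclass id Q E) cs
      covers′ : Covers pivot E (classMembers cs ++ others) (classMembers cs′ ++ members f′)
      covers′ p∈ e∈ with ∈-++⁻ (classMembers cs) p∈
      ... | inj₁ p∈cs     = AnyP.++⁺ˡ (reclass-covers id Q E pivot cs (λ R L e → shift-+≈+lower e (proj₁ R) (proj₁ L) pivot) p∈cs e∈)
      ... | inj₂ p∈others = AnyP.++⁺ʳ (classMembers cs′) (covers p∈others e∈)

  reduction-top : ∀ {D} R₀ Ls cs (f : Family D) → members f ≡ [] → Reduction (step ((R₀ , Ls) ∷ cs) f)
  reduction-top {D} (R₀ , R₀-poly) Ls cs f f≡[] = record
    { pivot       = R₀
    ; pivot-poly  = R₀-poly
    ; others      = classMembers (((R₀ , R₀-poly) , Ls) ∷ cs)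
    ; others-poly = classMembers-poly (((R₀ , R₀-poly) , Ls) ∷ cs)
    ; members⊆    = members⊆′
    ; reduce      = reduce′
    }
    where
    top = classMembers (((R₀ , R₀-poly) , Ls) ∷ cs)
    members⊆′ : ∀ {p} → p ∈ top ++ members f → p ∈ R₀ ∷ top
    members⊆′ {p} p∈ with ∈-++⁻ top p∈
    ... | inj₁ p∈top = there p∈top
    ... | inj₂ p∈f with ≡.subst (p ∈_) f≡[] p∈f
    ...   | ()
    lead : IPPoly (suc D) → IPPoly (suc D)
    lead (R , R-poly) = R -ᶠ R₀ , Poly≤-sub (suc D) R-poly R₀-poly
    Q : List ℕ → IPPoly D
    Q e = ΔPoly e (R₀ , R₀-poly)
    reduce′ : ∀ E → Σ (Family (suc D)) λ f′ → weight f′ <ʷ weight (step (((R₀ , R₀-poly) , Ls) ∷ cs) f) ×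
                Covers R₀ E top (members f′)
    reduce′ E =
      step cs′ (singletons D hs) , this (s≤s (≤-reflexive (length-map _ cs))) ≡.refl , covers′
      where
      cs′ = map (reclass lead Q E) cs
      hs = cartesianProductWith (λ L e → shiftPoly e L) Ls E
      covers′ : Covers R₀ E top (classMembers cs′ ++ members (singletons D hs))
      covers′ p∈ e∈ with ∈-++⁻ (membersOf ((R₀ , R₀-poly) , Ls)) p∈
      ... | inj₁ p∈first with ∈-map⁻ _ p∈first
      ...   | L , L∈Ls , ≡.refl =
        AnyP.++⁺ʳ (classMembers cs′)
          (Any.map (λ ≈L β → trans (≈L β) (shift-+≈shift _ R₀ (proj₁ L) β))
            (singletons-covers D (∈-cartesianProductWith⁺ (λ L e → shiftPoly e L) L∈Ls e∈)))
      covers′ p∈ e∈ | inj₂ p∈cs = AnyP.++⁺ˡ (reclass-covers lead Q E R₀ cs (λ R L e → shift-+≈-+lower e (proj₁ R) R₀ (proj₁ L)) p∈cs e∈)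

  -- The pivot has the lowest degree present: the reduced family keeps the class counts above that
  -- degree and has one class fewer at it.
  reduction : ∀ {D} (f : Family D) → members f ≡ [] ⊎ Reduction f
  reduction none     = inj₁ ≡.refl
  reduction onlyZero = inj₂ record
    { pivot       = 0ᶠ
    ; pivot-poly  = Poly≤-0ᶠ 0
    ; others      = []
    ; others-poly = λ ()
    ; members⊆    = id
    ; reduce      = λ E → none , this (s≤s z≤n) ≡.refl , λ ()
    }
  reduction (step cs f) with reduction f
  ... | inj₂ red = inj₂ (reduction-lower cs f red)
  reduction (step [] f)               | inj₁ f≡[] = inj₁ f≡[]
  reduction (step ((R₀ , Ls) ∷ cs) f) | inj₁ f≡[] = inj₂ (reduction-top R₀ Ls cs f f≡[])

module IPvanDerWaerden {c ℓ} (G : AbelianGroup c ℓ) where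
  open AbelianGroup G renaming (_∙_ to _+_; ε to 0#; _⁻¹ to -_)
  open AbelianGroupSolver G
  open IPPolynomials G
  open PETFamilies G

  Candidate : Set c
  Candidate = Carrier × List ℕ

  Monochromatic : ∀ {r} → (Carrier → Fin r) → List IPMap → Candidate → Set c
  Monochromatic χ Qs (a , γ) = ∃ λ k → All (λ p → χ (a + p γ) ≡ k) Qs

  -- One finite list of candidates serves every r-colouring; the bound lets later index sets be
  -- chosen disjoint from those used here.
  record VdWWitness (M : ℕ) (Qs : List IPMap) (r : ℕ) : Set (c ⊔ ℓ) where
    field
      bound         : ℕ
      candidates    : List Candidate
      in-range      : All (λ cd → IndexSet M bound (proj₂ cd)) candidates
      monochromatic : (χ : Carrier → Fin r) → χ Preserves _≈_ ⟶ _≡_ → Any (Monochromatic χ Qs) candidates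

  IPvdW : ℕ → List IPMap → Set (c ⊔ ℓ)
  IPvdW M Qs = ∀ r → VdWWitness M Qs r

  IPvdW-⊆ : ∀ {M Qs Qs′} → (∀ {p} → p ∈ Qs′ → p ∈ Qs) → IPvdW M Qs → IPvdW M Qs′
  IPvdW-⊆ Qs′⊆Qs vdW r = record
    { VdWWitness (vdW r)
    ; monochromatic = λ χ χ-resp → Any.map (λ (k , all≡k) → k , All.tabulate (All.lookup all≡k ∘ Qs′⊆Qs))
                                           (VdWWitness.monochromatic (vdW r) χ χ-resp)
    }

  IPvdW-[_] : ∀ q M → IPvdW M (q ∷ [])
  IPvdW-[ q ] M r = record
    { bound         = suc M
    ; candidates    = (0# , M ∷ []) ∷ []
    ; in-range      = ((λ ()) , [] ∷ [] , (≤-refl , ≤-refl) ∷ []) ∷ []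
    ; monochromatic = λ χ _ → here (χ (0# + q (M ∷ [])) , ≡.refl ∷ [])
    }

  Reducible : IPMap → List IPMap → Set (c ⊔ ℓ)
  Reducible q Ps = ∀ E → Σ (List IPMap) λ Qs → (∀ M → IPvdW M Qs) × Covers q E Ps Qs

  module ColourFocusing
    (q : IPMap) (Ps : List IPMap) {p₀ : IPMap} (p₀∈Ps : p₀ ∈ Ps)
    (q-∅ : q [] ≈ 0#) (Ps-∅ : ∀ {p} → p ∈ Ps → p [] ≈ 0#)
    (reducible : Reducible q Ps) (r M : ℕ) where

    open import Data.List.Membership.DecPropositional (_≟ᶠ_ {r}) using (_∈?_)

    Config : Set c
    Config = Carrier × List (List ℕ)

    spoke : Carrier → List ℕ → IPMap → Carrier
    spoke F e p = (F + - q e) + p e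

    spoke-∅ : ∀ F {p} → p ∈ Ps → spoke F [] p ≈ F
    spoke-∅ F p∈Ps = trans (∙-cong (∙-congˡ (⁻¹-cong q-∅)) (Ps-∅ p∈Ps)) (solve 1 (λ x → (x ⊖ ∅) ⊕ ∅ ⊜ x) refl F)

    spoke-shift : ∀ b F d {e p p′} → p′ ≈ᶠ shift e p -ᶠ shift e q → spoke (b + F) (e ++ d) p ≈ (b + p′ d) + spoke F e p
    spoke-shift b F d {e} {p} p′≈ = sym (trans (∙-congʳ (∙-congˡ (p′≈ d)))
      (solve 6 (λ x y u u₀ v v₀ → (x ⊕ ((u ⊖ u₀) ⊖ (v ⊖ v₀))) ⊕ ((y ⊖ v₀) ⊕ u₀) ⊜ ((x ⊕ y) ⊖ v) ⊕ u)
        refl b F (p (e ++ d)) (p e) (q (e ++ d)) (q e)))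

    SpokeColour : (Carrier → Fin r) → Carrier → List ℕ → Fin r → Set c
    SpokeColour χ F e k = All (λ p → χ (spoke F e p) ≡ k) Ps

    Focused : (Carrier → Fin r) → Config → Set c
    Focused χ (F , es) = ∃ λ ks → Pointwise (SpokeColour χ F) es ks × Unique (χ F ∷ ks)

    solutionsOf : Config → List Candidate
    solutionsOf (F , es) = map (λ e → F + - q e , e) es

    focus-solution : ∀ {χ} → χ Preserves _≈_ ⟶ _≡_ → ∀ {F es ks} → Pointwise (SpokeColour χ F) es ks → χ F ∈ ks →
      Any (Monochromatic χ (q ∷ Ps)) (solutionsOf (F , es))
    focus-solution χ-resp {F} (coloured ∷ _) (here χF≡k) =
      here (_ , ≡.trans (χ-resp (solve 2 (λ x y → (x ⊖ y) ⊕ y ⊜ x) refl F _)) χF≡k ∷ coloured)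
    focus-solution χ-resp (_ ∷ pw) (there χF∈ks) = there (focus-solution χ-resp pw χF∈ks)

    record Stage (s : ℕ) : Set (c ⊔ ℓ) where
      field
        N                  : ℕ
        M≤N                : M ≤ N
        solutions          : List Candidate
        configs            : List Config
        solutions-in-range : All (λ cd → IndexSet M N (proj₂ cd)) solutions
        configs-in-range   : All (λ cf → length (proj₂ cf) ≡ s × All (IndexSet M N) (proj₂ cf)) configs
        progress           : (χ : Carrier → Fin r) → χ Preserves _≈_ ⟶ _≡_ →
                             Any (Monochromatic χ (q ∷ Ps)) solutions ⊎ Any (Focused χ) configs

    stage₀ : Stage 0
    stage₀ = record
      { N                  = M
      ; M≤N                = ≤-refl
      ; solutions          = []
      ; configs            = (0# , []) ∷ []
      ; solutions-in-range = []
      ; configs-in-range   = (≡.refl , []) ∷ []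
      ; progress           = λ χ _ → inj₂ (here ([] , [] , [] ∷ []))
      }

    module Step {s} (st : Stage s) where
      open Stage st

      E : List (List ℕ)
      E = [] ∷ concatMap proj₂ configs

      Qs : List IPMap
      Qs = proj₁ (reducible E)

      Qs-covers : Covers q E Ps Qs
      Qs-covers = proj₂ (proj₂ (reducible E))

      spokesOf : Config → List Carrier
      spokesOf (F , es) = cartesianProductWith (spoke F) ([] ∷ es) Ps

      allSpokes : List Carrier
      allSpokes = concatMap spokesOf configs

      open VdWWitness (proj₁ (proj₂ (reducible E)) N (r ^ length allSpokes))
        renaming (bound to N′; candidates to translations; in-range to translations-in-range;
                  monochromatic to translations-monochromatic)

      p* : IPMap
      p* = proj₁ (find (Qs-covers p₀∈Ps (here ≡.refl)))

      p*∈Qs : p* ∈ Qs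
      p*∈Qs = proj₁ (proj₂ (find (Qs-covers p₀∈Ps (here ≡.refl))))

      origin : Candidate → Carrier
      origin (b , d) = b + p* d

      extendSolution : Candidate → Candidate → Candidate
      extendSolution bd (a , γ) = origin bd + a , γ

      extendConfig : Candidate → Config → Config
      extendConfig (b , d) (F , es) = b + F , map (_++ d) ([] ∷ es)

      configs′ : List Config
      configs′ = cartesianProductWith extendConfig translations configs

      solutions′ : List Candidate
      solutions′ = cartesianProductWith extendSolution translations solutions ++ concatMap solutionsOf configs′

      configs′-in-range : All (λ cf → length (proj₂ cf) ≡ suc s × All (IndexSet M (N +ℕ N′)) (proj₂ cf)) configs′
      configs′-in-range = AllP.cartesianProductWith⁺ (≡.setoid _) (≡.setoid _) extendConfig translations configs
        λ {bd} {cf} bd∈ cf∈ →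
          let d-set           = IndexSet-widen (m≤n+m N′ N) (All.lookup translations-in-range bd∈)
              length≡s , es-set = All.lookup configs-in-range cf∈
          in ≡.cong suc (≡.trans (length-map _ (proj₂ cf)) length≡s) ,
             IndexSet-lower M≤N d-set ∷ AllP.map⁺ (All.map (λ e-set → IndexSet-++ e-set d-set) es-set)

      solutions′-in-range : All (λ cd → IndexSet M (N +ℕ N′) (proj₂ cd)) solutions′
      solutions′-in-range = AllP.++⁺
        (AllP.cartesianProductWith⁺ (≡.setoid _) (≡.setoid _) extendSolution translations solutions
          λ _ sol∈ → IndexSet-widen (m≤m+n N N′) (All.lookup solutions-in-range sol∈))
        (AllP.concat⁺ (AllP.map⁺ (All.map (λ (_ , es-set) → AllP.map⁺ es-set) configs′-in-range)))

      E-∋ : ∀ {F es e} → (F , es) ∈ configs → e ∈ [] ∷ es → e ∈ E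
      E-∋ _    (here e≡[])  = here e≡[]
      E-∋ cf∈ (there e∈es) = there (∈-concatMap⁺ proj₂ (lose cf∈ e∈es))

      module _ (χ : Carrier → Fin r) (χ-resp : χ Preserves _≈_ ⟶ _≡_) where

        ĉ : Carrier → Fin (r ^ length allSpokes)
        ĉ = jointColouring (λ z y → χ (y + z)) allSpokes

        ĉ-resp : ĉ Preserves _≈_ ⟶ _≡_
        ĉ-resp x≈y = jointColouring-cong _ allSpokes (All.universal (λ _ → χ-resp (∙-congʳ x≈y)) allSpokes)

        -- ĉ y records the χ-colours of y + z for all spokes z, so on a ĉ-monochromatic translate
        -- (b , d) of the reduced system the spokes of the extended configuration take the
        -- χ₀-colours of the old spokes.
        module Extend {b d} (bd∈ : (b , d) ∈ translations) (mono : Monochromatic ĉ Qs (b , d)) where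

          χ₀ : Carrier → Fin r
          χ₀ y = χ (origin (b , d) + y)

          χ₀-resp : χ₀ Preserves _≈_ ⟶ _≡_
          χ₀-resp x≈y = χ-resp (∙-congˡ x≈y)

          agree : ∀ {p′} → p′ ∈ Qs → ∀ {z} → z ∈ allSpokes → χ ((b + p′ d) + z) ≡ χ₀ z
          agree p′∈ = All.lookup (jointColouring-injective _ allSpokes
            (≡.trans (All.lookup (proj₂ mono) p′∈) (≡.sym (All.lookup (proj₂ mono) p*∈Qs))))

          spoke-colour : ∀ {F es e p} → (F , es) ∈ configs → e ∈ [] ∷ es → p ∈ Ps →
            χ (spoke (b + F) (e ++ d) p) ≡ χ₀ (spoke F e p)
          spoke-colour {F} {es} {e} {p} cf∈ e∈ p∈ with find (Qs-covers p∈ (E-∋ cf∈ e∈))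
          ... | p′ , p′∈ , p′≈ = ≡.trans (χ-resp (spoke-shift b F d {e} {p} p′≈))
            (agree p′∈ (∈-concatMap⁺ spokesOf (lose cf∈ (∈-cartesianProductWith⁺ (spoke F) e∈ p∈))))

          extend-solution : ∀ {sol} → Monochromatic χ₀ (q ∷ Ps) sol → Monochromatic χ (q ∷ Ps) (extendSolution (b , d) sol)
          extend-solution (k , all≡k) = k , All.map (≡.trans (χ-resp (assoc _ _ _))) all≡k

          extend-spokes : ∀ {F es ks} → (F , es) ∈ configs → Pointwise (SpokeColour χ₀ F) es ks →
            Pointwise (SpokeColour χ (b + F)) (map (_++ d) ([] ∷ es)) (χ₀ F ∷ ks)
          extend-spokes {F} {es} cf∈ pw =
            All.tabulate (λ p∈ → ≡.trans (spoke-colour cf∈ (here ≡.refl) p∈) (χ₀-resp (spoke-∅ F p∈))) ∷ later id pw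
            where
            later : ∀ {es′ ks′} → (∀ {e} → e ∈ es′ → e ∈ es) → Pointwise (SpokeColour χ₀ F) es′ ks′ →
              Pointwise (SpokeColour χ (b + F)) (map (_++ d) es′) ks′
            later ⊆es []              = []
            later ⊆es (coloured ∷ pw′) =
              All.tabulate (λ p∈ → ≡.trans (spoke-colour cf∈ (there (⊆es (here ≡.refl))) p∈) (All.lookup coloured p∈))
              ∷ later (⊆es ∘ there) pw′

          extend-focused : ∀ {F es} → (F , es) ∈ configs → Focused χ₀ (F , es) →
            Focused χ (extendConfig (b , d) (F , es)) ⊎ Any (Monochromatic χ (q ∷ Ps)) (solutionsOf (extendConfig (b , d) (F , es)))
          extend-focused {F} cf∈ (ks , pw , uks) with χ (b + F) ∈? (χ₀ F ∷ ks)
          ... | yes hit  = inj₂ (focus-solution χ-resp (extend-spokes cf∈ pw) hit)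
          ... | no  miss = inj₁ (χ₀ F ∷ ks , extend-spokes cf∈ pw , ¬Any⇒All¬ _ miss ∷ uks)

          progress′ : Any (Monochromatic χ (q ∷ Ps)) solutions′ ⊎ Any (Focused χ) configs′
          progress′ with progress χ₀ χ₀-resp
          ... | inj₁ hit with find hit
          ...   | sol , sol∈ , mono₀ =
            inj₁ (lose (∈-++⁺ˡ (∈-cartesianProductWith⁺ extendSolution bd∈ sol∈)) (extend-solution mono₀))
          progress′ | inj₂ foc with find foc
          ...   | cf , cf∈ , focused with extend-focused cf∈ focused
          ...     | inj₁ focused′ = inj₂ (lose (∈-cartesianProductWith⁺ extendConfig bd∈ cf∈) focused′)
          ...     | inj₂ hit      = inj₁ (AnyP.++⁺ʳ (cartesianProductWith extendSolution translations solutions)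
                                          (AnyP.concatMap⁺ solutionsOf (lose (∈-cartesianProductWith⁺ extendConfig bd∈ cf∈) hit)))

        progress′ : Any (Monochromatic χ (q ∷ Ps)) solutions′ ⊎ Any (Focused χ) configs′
        progress′ with find (translations-monochromatic ĉ ĉ-resp)
        ... | _ , bd∈ , mono = Extend.progress′ bd∈ mono

      advance : Stage (suc s)
      advance = record
        { N                  = N +ℕ N′
        ; M≤N                = ≤-trans M≤N (m≤m+n N N′)
        ; solutions          = solutions′
        ; configs            = configs′
        ; solutions-in-range = solutions′-in-range
        ; configs-in-range   = configs′-in-range
        ; progress           = progress′
        }

    stage : ∀ s → Stage s
    stage zero    = stage₀
    stage (suc s) = Step.advance (stage s)

    witness : VdWWitness M (q ∷ Ps) r
    witness = record
      { bound         = N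
      ; candidates    = solutions
      ; in-range      = solutions-in-range
      ; monochromatic = λ χ χ-resp → [ id , ⊥-elim ∘ unfocused χ ]′ (progress χ χ-resp)
      }
      where
      open Stage (stage r)
      -- A focused configuration at stage r would carry r + 1 distinct colours.
      unfocused : ∀ χ → Any (Focused χ) configs → ⊥
      unfocused χ foc with find foc
      ... | (F , es) , cf∈ , ks , pw , uks =
        1+n≰n (≡.subst (λ n → suc n ≤ r) (≡.trans (≡.sym (Pointwise-length pw)) (proj₁ (All.lookup configs-in-range cf∈)))
                (Unique⇒length≤ uks))

  IPvdW-pivot : ∀ q Ps → q [] ≈ 0# → (∀ {p} → p ∈ Ps → p [] ≈ 0#) → Reducible q Ps → ∀ M → IPvdW M (q ∷ Ps)
  IPvdW-pivot q []       _   _    _         M   = IPvdW-[ q ] M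
  IPvdW-pivot q (p ∷ Ps) q-∅ Ps-∅ reducible M r =
    ColourFocusing.witness q (p ∷ Ps) (here ≡.refl) q-∅ Ps-∅ reducible r M

  pet : ∀ {D} (f : Family D) → Acc _<ʷ_ (weight f) → ∀ M → IPvdW M (members f)
  pet f (acc rec) M with reduction f
  ... | inj₁ f≡[] = ≡.subst (IPvdW M) (≡.sym f≡[]) (IPvdW-⊆ (λ ()) (IPvdW-[ 0ᶠ ] M))
  ... | inj₂ red  =
    IPvdW-⊆ members⊆ (IPvdW-pivot pivot others (Poly≤-∅ _ pivot-poly) (Poly≤-∅ _ ∘ others-poly) reducible M)
    where
    open Reduction red
    reducible : Reducible pivot others
    reducible E with reduce E
    ... | f′ , f′<f , covers = members f′ , pet f′ (rec f′<f) , covers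

  IPvdW-colouring : ∀ {M Qs} → IPvdW M Qs → ∀ {r} (χ : Carrier → Fin r) → χ Preserves _≈_ ⟶ _≡_ →
    Σ Carrier λ h → Σ (List ℕ) λ γ → γ ≢ [] × Unique γ ×
      (∀ {Φ Ψ} → Φ ∈≈ Qs → Ψ ∈≈ Qs → χ (h + Φ γ) ≡ χ (h + Ψ γ))
  IPvdW-colouring vdW {r} χ χ-resp =
    let (h , γ) , cd∈ , k , all≡k = find (VdWWitness.monochromatic (vdW r) χ χ-resp)
        γ≢[] , uγ , _             = All.lookup (VdWWitness.in-range (vdW r)) cd∈
    in h , γ , γ≢[] , uγ , λ Φ∈≈ Ψ∈≈ → ≡.trans (coloured h γ all≡k Φ∈≈) (≡.sym (coloured h γ all≡k Ψ∈≈))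
    where
    coloured : ∀ {Qs k} h γ → All (λ p → χ (h + p γ) ≡ k) Qs → ∀ {Φ} → Φ ∈≈ Qs → χ (h + Φ γ) ≡ k
    coloured h γ all≡k Φ∈≈ with find Φ∈≈
    ... | Φ′ , Φ′∈Qs , Φ′≈Φ = ≡.trans (χ-resp (∙-congˡ (sym (Φ′≈Φ γ)))) (All.lookup all≡k Φ′∈Qs)

module IPPolynomialsOverRing {c ℓ} (R : Ring c ℓ) where
  open Ring R
  open import Algebra.Properties.Ring R using (-‿distribˡ-*; -‿distribʳ-*; -0#≈0#)
  open RingDefs R
  open AbelianGroupSolver +-abelianGroup
  open IPPolynomials +-abelianGroup
  open import Relation.Binary.Reasoning.Setoid setoid

  Additive : IPMap → Set ℓ
  Additive Λ = ∀ α β → Λ (α ++ β) ≈ Λ α + Λ β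

  Additive⇒Poly≤1 : ∀ {Λ} → Additive Λ → Poly≤ 1 Λ
  Additive⇒Poly≤1 {Λ} add α β = begin
    (Λ (α ++ β) + - Λ α) + - Λ β   ≈⟨ +-congʳ (+-congʳ (add α β)) ⟩
    ((Λ α + Λ β) + - Λ α) + - Λ β  ≈⟨ solve 2 (λ x y → ((x ⊕ y) ⊖ x) ⊖ y ⊜ ∅) refl (Λ α) (Λ β) ⟩
    0#                             ∎

  Additive-*ʳ : ∀ {Λ} → Additive Λ → ∀ a → Additive (λ γ → Λ γ * a)
  Additive-*ʳ add a α β = trans (*-congʳ (add α β)) (distribʳ a _ _)

  Δ-*ˡ : ∀ a α Φ → Δ α (λ γ → a * Φ γ) ≈ᶠ (λ γ → a * Δ α Φ γ)
  Δ-*ˡ a α Φ β = sym (begin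
    a * ((Φ (α ++ β) + - Φ α) + - Φ β)          ≈⟨ distribˡ a _ _ ⟩
    a * (Φ (α ++ β) + - Φ α) + a * - Φ β        ≈⟨ +-cong (distribˡ a _ _) (sym (-‿distribʳ-* a _)) ⟩
    (a * Φ (α ++ β) + a * - Φ α) + - (a * Φ β)  ≈⟨ +-congʳ (+-congˡ (sym (-‿distribʳ-* a _))) ⟩
    (a * Φ (α ++ β) + - (a * Φ α)) + - (a * Φ β) ∎)

  Δ-*ʳ : ∀ a α Φ → Δ α (λ γ → Φ γ * a) ≈ᶠ (λ γ → Δ α Φ γ * a)
  Δ-*ʳ a α Φ β = sym (begin
    ((Φ (α ++ β) + - Φ α) + - Φ β) * a          ≈⟨ distribʳ a _ _ ⟩
    (Φ (α ++ β) + - Φ α) * a + - Φ β * a        ≈⟨ +-cong (distribʳ a _ _) (sym (-‿distribˡ-* _ a)) ⟩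
    (Φ (α ++ β) * a + - Φ α * a) + - (Φ β * a)  ≈⟨ +-congʳ (+-congˡ (sym (-‿distribˡ-* _ a))) ⟩
    (Φ (α ++ β) * a + - (Φ α * a)) + - (Φ β * a) ∎)

  Poly≤-*ˡ : ∀ d a {Φ} → Poly≤ d Φ → Poly≤ d (λ γ → a * Φ γ)
  Poly≤-*ˡ zero    a p γ = trans (*-congˡ (p γ)) (zeroʳ a)
  Poly≤-*ˡ (suc d) a {Φ} p α = Poly≤-resp d (λ β → sym (Δ-*ˡ a α Φ β)) (Poly≤-*ˡ d a (p α))

  Poly≤-*ʳ : ∀ d a {Φ} → Poly≤ d Φ → Poly≤ d (λ γ → Φ γ * a)
  Poly≤-*ʳ zero    a p γ = trans (*-congʳ (p γ)) (zeroˡ a)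
  Poly≤-*ʳ (suc d) a {Φ} p α = Poly≤-resp d (λ β → sym (Δ-*ʳ a α Φ β)) (Poly≤-*ʳ d a (p α))

  *-distrib-+₃ : ∀ x y u v w → (x + y) * ((u + v) + w) ≈ ((x * u + x * v) + x * w) + ((y * u + y * v) + y * w)
  *-distrib-+₃ x y u v w = begin
    (x + y) * ((u + v) + w)                            ≈⟨ distribʳ _ x y ⟩
    x * ((u + v) + w) + y * ((u + v) + w)              ≈⟨ +-cong (expand x) (expand y) ⟩
    ((x * u + x * v) + x * w) + ((y * u + y * v) + y * w) ∎
    where
    expand : ∀ z → z * ((u + v) + w) ≈ (z * u + z * v) + z * w
    expand z = trans (distribˡ z _ _) (+-congʳ (distribˡ z u v))

  Δ-Additive-* : ∀ {Λ} → Additive Λ → ∀ α Ψ →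
    Δ α (λ γ → Λ γ * Ψ γ) ≈ᶠ (λ β → ((Λ α * Ψ β + Λ α * Δ α Ψ β) + Λ β * Ψ α) + Λ β * Δ α Ψ β)
  Δ-Additive-* {Λ} add α Ψ β = begin
    (Λ (α ++ β) * Ψ (α ++ β) + - (Λ α * Ψ α)) + - (Λ β * Ψ β)
      ≈⟨ +-congʳ (+-congʳ (*-cong (add α β) (Δ-split α β Ψ))) ⟩
    ((Λ α + Λ β) * ((Ψ α + Ψ β) + D) + - (Λ α * Ψ α)) + - (Λ β * Ψ β)
      ≈⟨ +-congʳ (+-congʳ (*-distrib-+₃ _ _ _ _ _)) ⟩
    ((((Λ α * Ψ α + Λ α * Ψ β) + Λ α * D) + ((Λ β * Ψ α + Λ β * Ψ β) + Λ β * D)) + - (Λ α * Ψ α)) + - (Λ β * Ψ β)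
      ≈⟨ solve 6 (λ x₁ x₂ x₃ y₁ y₂ y₃ → ((((x₁ ⊕ x₂) ⊕ x₃) ⊕ ((y₁ ⊕ y₂) ⊕ y₃)) ⊖ x₁) ⊖ y₂ ⊜ ((x₂ ⊕ x₃) ⊕ y₁) ⊕ y₃)
           refl (Λ α * Ψ α) (Λ α * Ψ β) (Λ α * D) (Λ β * Ψ α) (Λ β * Ψ β) (Λ β * D) ⟩
    ((Λ α * Ψ β + Λ α * D) + Λ β * Ψ α) + Λ β * D ∎
    where D = Δ α Ψ β

  Poly≤-Additive-* : ∀ d {Λ Ψ} → Additive Λ → Poly≤ d Ψ → Poly≤ (suc d) (λ γ → Λ γ * Ψ γ)
  Poly≤-Additive-* zero    add p =
    Poly≤-resp 1 (λ γ → sym (trans (*-congˡ (p γ)) (zeroʳ _))) (Poly≤-0ᶠ 1)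
  Poly≤-Additive-* (suc d) {Λ} {Ψ} add p α =
    Poly≤-resp (suc d) (λ β → sym (Δ-Additive-* add α Ψ β))
      (Poly≤-+ (suc d) (Poly≤-+ (suc d) (Poly≤-+ (suc d)
        (Poly≤-*ˡ (suc d) (Λ α) p)
        (Poly≤-suc d (Poly≤-*ˡ d (Λ α) (p α))))
        (Poly≤-mono (s≤s z≤n) (Poly≤-*ʳ 1 (Ψ α) (Additive⇒Poly≤1 add))))
        (Poly≤-Additive-* d add (p α)))

  degree : ∀ {n} → Polynomial n → ℕ
  degree []      = 0
  degree (m ∷ p) = length (Monomial.tail′ m) +ℕ degree p

  module _ {n} {X : List ℕ → Vecᴿ n} (X-additive : ∀ i → Additive (λ γ → X γ i)) where

    Poly≤-evalTail : ∀ m ms → Poly≤ (length (m ∷ ms)) (λ γ → evalTail (X γ) (m ∷ ms))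
    Poly≤-evalTail (i , a) []       =
      Poly≤-resp 1 (λ γ → sym (*-identityʳ _)) (Additive⇒Poly≤1 (Additive-*ʳ (X-additive i) a))
    Poly≤-evalTail (i , a) (m ∷ ms) =
      Poly≤-Additive-* (length (m ∷ ms)) (Additive-*ʳ (X-additive i) a) (Poly≤-evalTail m ms)

    Poly≤-evalMono : ∀ m → Poly≤ (length (Monomial.tail′ m)) (λ γ → evalMono m (X γ) + - evalMono m zeroV)
    Poly≤-evalMono (mono a [])             γ = -‿inverseʳ _
    Poly≤-evalMono (mono a ((i , b) ∷ ms)) =
      Poly≤-resp (suc (length ms)) (λ γ → sym (trans (+-congˡ (trans (-‿cong vanishes) -0#≈0#)) (+-identityʳ _)))
        (Poly≤-*ˡ (suc (length ms)) a (Poly≤-evalTail (i , b) ms))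
      where
      vanishes : a * ((0# * b) * evalTail zeroV ms) ≈ 0#
      vanishes = trans (*-congˡ (trans (*-congʳ (zeroˡ b)) (zeroˡ _))) (zeroʳ a)

    Poly≤-evalPoly-sub : ∀ p → Poly≤ (degree p) (λ γ → evalPoly p (X γ) + - evalPoly p zeroV)
    Poly≤-evalPoly-sub []      γ = -‿inverseʳ _
    Poly≤-evalPoly-sub (m ∷ p) =
      Poly≤-resp (degree (m ∷ p))
        (λ γ → solve 4 (λ x x₀ y y₀ → (x ⊖ x₀) ⊕ (y ⊖ y₀) ⊜ (x ⊕ y) ⊖ (x₀ ⊕ y₀)) refl
                 (evalMono m (X γ)) (evalMono m zeroV) (evalPoly p (X γ)) (evalPoly p zeroV))
        (Poly≤-+ (degree (m ∷ p))
          (Poly≤-mono (m≤m+n _ (degree p)) (Poly≤-evalMono m))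
          (Poly≤-mono (m≤n+m (degree p) _) (Poly≤-evalPoly-sub p)))

    Poly≤-evalPoly : ∀ p → evalPoly p zeroV ≈ 0# → Poly≤ (degree p) (λ γ → evalPoly p (X γ))
    Poly≤-evalPoly p p0≈0 = Poly≤-resp (degree p)
      (λ γ → trans (+-congˡ (trans (-‿cong p0≈0) -0#≈0#)) (+-identityʳ _))
      (Poly≤-evalPoly-sub p)

  sumSeq-++ : ∀ {n} (g : ℕ → Vecᴿ n) α β i → sumSeq g (α ++ β) i ≈ sumSeq g α i + sumSeq g β i
  sumSeq-++ g []      β i = sym (+-identityˡ _)
  sumSeq-++ g (j ∷ α) β i = trans (+-congˡ (sumSeq-++ g α β i)) (sym (+-assoc _ _ _))

  sumSeq-⊙-additive : ∀ {n} (g : ℕ → Vecᴿ n) v i → Additive (λ γ → (sumSeq g γ ⊙ v) i)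
  sumSeq-⊙-additive g v i = Additive-*ʳ (λ α β → sumSeq-++ g α β i) (v i)

module _ {c ℓ i} (I : Set i) (G : AbelianGroup c ℓ) where
  private
    module G  = IPPolynomials G
    module Gᴵ = IPPolynomials (Pointwise.abelianGroup I G)

  Poly≤-pointwise : ∀ d {Φ : List ℕ → I → AbelianGroup.Carrier G} → (∀ k → G.Poly≤ d (λ γ → Φ γ k)) → Gᴵ.Poly≤ d Φ
  Poly≤-pointwise zero    Φₖ-poly γ k = Φₖ-poly k γ
  Poly≤-pointwise (suc d) Φₖ-poly α   = Poly≤-pointwise d (λ k → Φₖ-poly k α)

proposition7p9 : ∀ {c ℓ} (R : Ring c ℓ) → let open RingDefs R in
    (n t : ℕ) (P : PolyMap n t) → evalMap P zeroV ≈V zeroV →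
    (g : ℕ → Vecᴿ n) (F : List (Vecᴿ n)) (r : ℕ) (χ : Vecᴿ t → Fin r) →
    (∀ {u v} → u ≈V v → χ u ≡ χ v) →
    Σ (Vecᴿ t) λ h → Σ (List ℕ) λ γ → (γ ≢ []) × Unique γ ×
      (∀ {v w} → v ∈ F → w ∈ F →
        χ (h +V evalMap P (sumSeq g γ ⊙ v)) ≡ χ (h +V evalMap P (sumSeq g γ ⊙ w)))
proposition7p9 R n t P P0 g F r χ χ-resp =
  let h , γ , γ≢[] , uγ , coloured = IPvdW-colouring (pet family (<ʷ-wellFounded _) 0) χ χ-resp
  in h , γ , γ≢[] , uγ , λ v∈F w∈F → coloured (covered v∈F) (covered w∈F)
  where
  open Ring R using (+-abelianGroup)
  open RingDefs R
  open IPPolynomialsOverRing R using (degree; Poly≤-evalPoly; sumSeq-⊙-additive)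
  open IPPolynomials +-abelianGroup using (Poly≤-mono)
  open PETFamilies (Pointwise.abelianGroup (Fin t) +-abelianGroup)
  open IPvanDerWaerden (Pointwise.abelianGroup (Fin t) +-abelianGroup)
  D : ℕ
  D = max 0 (map (λ k → degree (P k)) (allFin t))
  Φ : Vecᴿ n → IPPoly D
  Φ v = (λ γ → evalMap P (sumSeq g γ ⊙ v)) ,
        Poly≤-pointwise (Fin t) +-abelianGroup D λ k →
          Poly≤-mono (All.lookup (xs≤max 0 _) (∈-map⁺ _ (∈-allFin k))) (Poly≤-evalPoly (sumSeq-⊙-additive g v) (P k) (P0 k))
  family : Family D
  family = singletons D (map Φ F)
  covered : ∀ {v} → v ∈ F → proj₁ (Φ v) ∈≈ members family
  covered v∈F = singletons-covers D (∈-map⁺ Φ v∈F)
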